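{- For every C-recursive sequence $s\in\mathbb Z^{\mathbb N}$ there exists $c\in\mathbb N$ such that the sequence defined by $u(n)=s(n)+c^{n+1}$ is C-recursive and consists of natural numbers.
   Context: $\mathbb N=\{0,1,2,\dots\}$. A sequence $s\in\mathbb Z^{\mathbb N}$ is C-recursive if there exist an integer $d\geq1$ and $\alpha_1,\dots,\alpha_d\in\mathbb Z$ with $\alpha_d\neq0$ such that $s(n+d)+\alpha_1s(n+d-1)+\dots+\alpha_ds(n)=0$ for every $n\geq0$. -}

module Defs where

open import Data.Nat as ℕ using (ℕ; suc)
open import Data.Integer using (ℤ; _+_; _*_; 0ℤ)
open import Data.Fin using (Fin; toℕ; zero; suc)
open import Data.Vec using (Vec; lookup; last)
open import Data.Product using (Σ; _×_)
open import Relation.Binary.PropositionalEquality using (_≡_; _≢_)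

sumFin : (m : ℕ) → (Fin m → ℤ) → ℤ
sumFin ℕ.zero    f = 0ℤ
sumFin (suc m) f = f zero + sumFin m (λ j → f (suc j))

-- Recurrence of order d = suc k with α = (α_1, …, α_d), stored as
-- lookup α j = α_{j+1}:
--   s(n+d) + Σ_{j<d} α_{j+1} s(n+d-(j+1)) = 0  for all n,
-- where n + d - (j+1) = n + (k - j) since j ≤ k.
satisfiesRec : (k : ℕ) → Vec ℤ (suc k) → (ℕ → ℤ) → Set
satisfiesRec k α s =
  ∀ (n : ℕ) →
    s (n ℕ.+ suc k)
      + sumFin (suc k) (λ j → lookup α j * s (n ℕ.+ (k ℕ.∸ toℕ j))) ≡ 0ℤ

CRecursive : (ℕ → ℤ) → Set
CRecursive s =
  Σ ℕ λ k → Σ (Vec ℤ (suc k)) λ α → (last α ≢ 0ℤ) × satisfiesRec k α s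

{-# OPTIONS --safe #-}
-- If P is the characteristic polynomial of s, then s and (cⁿ⁺¹) both satisfy the recurrence
-- with characteristic polynomial (X − c)·P, whose constant term −c·α_d is nonzero when c is.
-- If the coefficients have absolute sum A and the initial values are bounded by B, then
-- c = 1 + A + B dominates s: beyond the initial values the recurrence gives, by strong
-- induction, |s n| ≤ A·cⁿ ≤ cⁿ⁺¹.
module Submission where

open import Defs
open import Data.Nat.Base as ℕ using (ℕ; zero; suc; _≤_; _<_; _⊔_; z≤n; s≤s; NonZero)
import Data.Nat.Properties as ℕ
open import Data.Nat.Induction using (<-rec)
open import Data.Integer
  using (ℤ; +_; -[1+_]; _+_; _-_; -_; _*_; _^_; _≥_; +≤+; 0ℤ; 1ℤ; ∣_∣)
import Data.Integer.Properties as ℤ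
open import Data.Integer.Tactic.RingSolver using (solve-∀)
open import Algebra.Properties.AbelianGroup ℤ.+-0-abelianGroup using (inverseˡ-unique)
open import Algebra.Properties.CommutativeSemigroup ℤ.+-commutativeSemigroup
  using (interchange)
open import Algebra.Properties.CommutativeSemigroup ℤ.*-commutativeSemigroup
  using (x∙yz≈y∙xz)
open import Data.Fin using (toℕ)
open import Data.Vec using (Vec; []; _∷_; lookup; last; map; sum)
open import Data.Product using (Σ; _×_; _,_)
open import Data.Sum using (inj₁; inj₂)
open import Function using (_∘_)
open import Relation.Binary.PropositionalEquality
open import Relation.Nullary using (yes; no)

weightedSum : ∀ {m} → Vec ℤ m → (ℕ → ℤ) → ℤ
weightedSum {m} α h = sumFin m (λ j → lookup α j * h (toℕ j))

weightedSum-cong : ∀ {m} (α : Vec ℤ m) {h h′ : ℕ → ℤ} →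
  (∀ i → i < m → h i ≡ h′ i) → weightedSum α h ≡ weightedSum α h′
weightedSum-cong []      _     = refl
weightedSum-cong (a ∷ α) h≗h′ =
  cong₂ _+_ (cong (a *_) (h≗h′ 0 (s≤s z≤n)))
            (weightedSum-cong α (λ i i<m → h≗h′ (suc i) (s≤s i<m)))

weightedSum-+ : ∀ {m} (α : Vec ℤ m) (h h′ : ℕ → ℤ) →
  weightedSum α (λ i → h i + h′ i) ≡ weightedSum α h + weightedSum α h′
weightedSum-+ []      h h′ = refl
weightedSum-+ (a ∷ α) h h′ =
  trans (cong₂ _+_ (ℤ.*-distribˡ-+ a (h 0) (h′ 0)) (weightedSum-+ α (h ∘ suc) (h′ ∘ suc)))
        (interchange (a * h 0) (a * h′ 0) _ _)

weightedSum-*ˡ : ∀ {m} (α : Vec ℤ m) c (h : ℕ → ℤ) →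
  weightedSum α (λ i → c * h i) ≡ c * weightedSum α h
weightedSum-*ˡ []      c h = sym (ℤ.*-zeroʳ c)
weightedSum-*ˡ (a ∷ α) c h =
  trans (cong₂ _+_ (x∙yz≈y∙xz a c (h 0)) (weightedSum-*ˡ α c (h ∘ suc)))
        (sym (ℤ.*-distribˡ-+ c (a * h 0) _))

∣weightedSum∣≤ : ∀ {m} (α : Vec ℤ m) (h : ℕ → ℤ) {X : ℕ} →
  (∀ i → i < m → ∣ h i ∣ ≤ X) → ∣ weightedSum α h ∣ ≤ sum (map ∣_∣ α) ℕ.* X
∣weightedSum∣≤ []      _ _ = z≤n
∣weightedSum∣≤ (a ∷ α) h {X} ∣h∣≤X = begin
  ∣ a * h 0 + weightedSum α (h ∘ suc) ∣        ≤⟨ ℤ.∣i+j∣≤∣i∣+∣j∣ (a * h 0) _ ⟩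
  ∣ a * h 0 ∣ ℕ.+ ∣ weightedSum α (h ∘ suc) ∣  ≤⟨ ℕ.+-mono-≤ head-bound tail-bound ⟩
  ∣ a ∣ ℕ.* X ℕ.+ sum (map ∣_∣ α) ℕ.* X        ≡⟨ ℕ.*-distribʳ-+ X ∣ a ∣ _ ⟨
  sum (map ∣_∣ (a ∷ α)) ℕ.* X                  ∎
  where
  open ℕ.≤-Reasoning
  head-bound : ∣ a * h 0 ∣ ≤ ∣ a ∣ ℕ.* X
  head-bound = ℕ.≤-trans (ℕ.≤-reflexive (ℤ.abs-* a (h 0)))
                         (ℕ.*-monoʳ-≤ ∣ a ∣ (∣h∣≤X 0 (s≤s z≤n)))
  tail-bound : ∣ weightedSum α (h ∘ suc) ∣ ≤ sum (map ∣_∣ α) ℕ.* X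
  tail-bound = ∣weightedSum∣≤ α (h ∘ suc) (λ i i<m → ∣h∣≤X (suc i) (s≤s i<m))

-- The coefficients of (X − c)·(Xᵈ + α₁Xᵈ⁻¹ + … + α_d) are α_j − c·α_{j−1} (with α₀ = 1),
-- followed by −c·α_d; the second argument of adjoinRootFrom is α_{j−1}.
adjoinRootFrom : ∀ {m} → ℤ → ℤ → Vec ℤ m → Vec ℤ (suc m)
adjoinRootFrom c p []      = - (c * p) ∷ []
adjoinRootFrom c p (a ∷ α) = a - c * p ∷ adjoinRootFrom c a α

adjoinRoot : ∀ {m} → ℤ → Vec ℤ m → Vec ℤ (suc m)
adjoinRoot c = adjoinRootFrom c 1ℤ

weightedSum-adjoinRootFrom : ∀ {m} c p (α : Vec ℤ m) h →
  weightedSum (adjoinRootFrom c p α) h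
    ≡ weightedSum α h - c * (p * h 0 + weightedSum α (h ∘ suc))
weightedSum-adjoinRootFrom c p []      h = base c p (h 0)
  where
  base : ∀ c p x → - (c * p) * x + 0ℤ ≡ 0ℤ - c * (p * x + 0ℤ)
  base = solve-∀
weightedSum-adjoinRootFrom c p (a ∷ α) h =
  trans (cong (_+_ ((a - c * p) * h 0)) (weightedSum-adjoinRootFrom c a α (h ∘ suc)))
        (step c p a (h 0) (h 1) (weightedSum α (h ∘ suc))
              (weightedSum α (λ i → h (suc (suc i)))))
  where
  step : ∀ c p a x y U V →
    (a - c * p) * x + (U - c * (a * y + V)) ≡ (a * x + U) - c * (p * x + (a * y + V))
  step = solve-∀

last-adjoinRootFrom : ∀ {m} c p (α : Vec ℤ m) →
  last (adjoinRootFrom c p α) ≡ - (c * last (p ∷ α))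
last-adjoinRootFrom c p []      = refl
last-adjoinRootFrom c p (a ∷ α) = last-adjoinRootFrom c a α

adjoinRoot-last≢0 : ∀ {k} c (α : Vec ℤ (suc k)) → c ≢ 0ℤ → last α ≢ 0ℤ →
  last (adjoinRoot c α) ≢ 0ℤ
adjoinRoot-last≢0 c α c≢0 α≢0 eq with ℤ.i*j≡0⇒i≡0∨j≡0 c c*α≡0
  where
  c*α≡0 : c * last α ≡ 0ℤ
  c*α≡0 = ℤ.neg-injective (trans (sym (last-adjoinRootFrom c 1ℤ α)) eq)
... | inj₁ c≡0 = c≢0 c≡0
... | inj₂ α≡0 = α≢0 α≡0

recurrenceLHS : (k : ℕ) → Vec ℤ (suc k) → (ℕ → ℤ) → ℕ → ℤ
recurrenceLHS k α s n = s (n ℕ.+ suc k) + weightedSum α (λ i → s (n ℕ.+ (k ℕ.∸ i)))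

recurrenceLHS-+ : ∀ k α (s t : ℕ → ℤ) n →
  recurrenceLHS k α (λ m → s m + t m) n ≡ recurrenceLHS k α s n + recurrenceLHS k α t n
recurrenceLHS-+ k α s t n =
  trans (cong (_+_ (s (n ℕ.+ suc k) + t (n ℕ.+ suc k))) (weightedSum-+ α (s ∘ lag) (t ∘ lag)))
        (interchange (s (n ℕ.+ suc k)) (t (n ℕ.+ suc k)) _ _)
  where
  lag : ℕ → ℕ
  lag i = n ℕ.+ (k ℕ.∸ i)

recurrenceLHS-*ˡ : ∀ k α c (s : ℕ → ℤ) n →
  recurrenceLHS k α (λ m → c * s m) n ≡ c * recurrenceLHS k α s n
recurrenceLHS-*ˡ k α c s n =
  trans (cong (_+_ (c * s (n ℕ.+ suc k))) (weightedSum-*ˡ α c (s ∘ lag)))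
        (sym (ℤ.*-distribˡ-+ c (s (n ℕ.+ suc k)) _))
  where
  lag : ℕ → ℕ
  lag i = n ℕ.+ (k ℕ.∸ i)

recurrenceLHS-adjoinRoot : ∀ k α c (s : ℕ → ℤ) n →
  recurrenceLHS (suc k) (adjoinRoot c α) s n
    ≡ recurrenceLHS k α s (suc n) - c * recurrenceLHS k α s n
recurrenceLHS-adjoinRoot k α c s n = begin
  s (n ℕ.+ suc (suc k)) + weightedSum (adjoinRoot c α) window
    ≡⟨ cong₂ _+_ (cong s (ℕ.+-suc n (suc k))) (weightedSum-adjoinRootFrom c 1ℤ α window) ⟩
  s (suc n ℕ.+ suc k) + (weightedSum α window - c * (1ℤ * window 0 + older))
    ≡⟨ cong (λ x → s (suc n ℕ.+ suc k) + (x - c * (1ℤ * window 0 + older)))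
            (weightedSum-cong α (λ i i<1+k → cong s (shift (ℕ.≤-pred i<1+k)))) ⟩
  s (suc n ℕ.+ suc k) + (newer - c * (1ℤ * window 0 + older))
    ≡⟨ rearrange (s (suc n ℕ.+ suc k)) newer c (window 0) older ⟩
  recurrenceLHS k α s (suc n) - c * recurrenceLHS k α s n
    ∎
  where
  open ≡-Reasoning
  window : ℕ → ℤ
  window i = s (n ℕ.+ (suc k ℕ.∸ i))
  older newer : ℤ
  older = weightedSum α (window ∘ suc)
  newer = weightedSum α (λ i → s (suc n ℕ.+ (k ℕ.∸ i)))
  shift : ∀ {i} → i ≤ k → n ℕ.+ (suc k ℕ.∸ i) ≡ suc n ℕ.+ (k ℕ.∸ i)
  shift {i} i≤k = trans (cong (n ℕ.+_) (ℕ.+-∸-assoc 1 i≤k)) (ℕ.+-suc n (k ℕ.∸ i))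
  rearrange : ∀ x a c y b → x + (a - c * (1ℤ * y + b)) ≡ (x + a) - c * (y + b)
  rearrange = solve-∀

satisfiesRec-+ : ∀ k α s t → satisfiesRec k α s → satisfiesRec k α t →
  satisfiesRec k α (λ n → s n + t n)
satisfiesRec-+ k α s t rec-s rec-t n =
  trans (recurrenceLHS-+ k α s t n) (cong₂ _+_ (rec-s n) (rec-t n))

satisfiesRec-adjoinRoot : ∀ k α s c → satisfiesRec k α s →
  satisfiesRec (suc k) (adjoinRoot c α) s
satisfiesRec-adjoinRoot k α s c rec n = begin
  recurrenceLHS (suc k) (adjoinRoot c α) s n
    ≡⟨ recurrenceLHS-adjoinRoot k α c s n ⟩
  recurrenceLHS k α s (suc n) - c * recurrenceLHS k α s n
    ≡⟨ cong₂ (λ x y → x - c * y) (rec (suc n)) (rec n) ⟩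
  0ℤ - c * 0ℤ
    ≡⟨ cong (_-_ 0ℤ) (ℤ.*-zeroʳ c) ⟩
  0ℤ
    ∎
  where open ≡-Reasoning

-- At n + 1 the left-hand side for (cⁿ⁺¹) is, definitionally, the one for (c·cⁿ⁺¹) at n.
satisfiesRec-adjoinRoot-geometric : ∀ k α c →
  satisfiesRec (suc k) (adjoinRoot c α) (λ n → c ^ suc n)
satisfiesRec-adjoinRoot-geometric k α c n = begin
  recurrenceLHS (suc k) (adjoinRoot c α) g n
    ≡⟨ recurrenceLHS-adjoinRoot k α c g n ⟩
  recurrenceLHS k α g (suc n) - c * recurrenceLHS k α g n
    ≡⟨ cong (_- c * recurrenceLHS k α g n) (recurrenceLHS-*ˡ k α c g n) ⟩
  c * recurrenceLHS k α g n - c * recurrenceLHS k α g n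
    ≡⟨ ℤ.+-inverseʳ (c * recurrenceLHS k α g n) ⟩
  0ℤ
    ∎
  where
  open ≡-Reasoning
  g : ℕ → ℤ
  g n = c ^ suc n

CRecursive-+-geometric : ∀ s c → c ≢ 0ℤ → CRecursive s →
  CRecursive (λ n → s n + c ^ suc n)
CRecursive-+-geometric s c c≢0 (k , α , α≢0 , rec) =
  suc k , adjoinRoot c α , adjoinRoot-last≢0 c α c≢0 α≢0 ,
  satisfiesRec-+ (suc k) (adjoinRoot c α) s (λ n → c ^ suc n)
    (satisfiesRec-adjoinRoot k α s c rec) (satisfiesRec-adjoinRoot-geometric k α c)

maxAbs : (ℕ → ℤ) → ℕ → ℕ
maxAbs s zero    = ∣ s 0 ∣
maxAbs s (suc n) = ∣ s (suc n) ∣ ⊔ maxAbs s n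

∣s∣≤maxAbs : ∀ s {i n} → i ≤ n → ∣ s i ∣ ≤ maxAbs s n
∣s∣≤maxAbs s {n = zero}  z≤n = ℕ.≤-refl
∣s∣≤maxAbs s {n = suc n} i≤1+n with ℕ.m≤n⇒m<n∨m≡n i≤1+n
... | inj₁ i<1+n = ℕ.m≤n⇒m≤o⊔n ∣ s (suc n) ∣ (∣s∣≤maxAbs s (ℕ.≤-pred i<1+n))
... | inj₂ refl  = ℕ.m≤m⊔n _ _

+≡0⇒∣i∣≡∣j∣ : ∀ i j → i + j ≡ 0ℤ → ∣ i ∣ ≡ ∣ j ∣
+≡0⇒∣i∣≡∣j∣ i j i+j≡0 = trans (cong ∣_∣ (inverseˡ-unique i j i+j≡0)) (ℤ.∣-i∣≡∣i∣ j)

∣s[n+k+1]∣≤ : ∀ k α s → satisfiesRec k α s → ∀ n {X} →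
  (∀ i → i < n ℕ.+ suc k → ∣ s i ∣ ≤ X) → ∣ s (n ℕ.+ suc k) ∣ ≤ sum (map ∣_∣ α) ℕ.* X
∣s[n+k+1]∣≤ k α s rec n ∣s∣≤X =
  ℕ.≤-trans (ℕ.≤-reflexive (+≡0⇒∣i∣≡∣j∣ (s (n ℕ.+ suc k)) _ (rec n)))
            (∣weightedSum∣≤ α (s ∘ lag) (λ i _ → ∣s∣≤X (lag i) (lag<n+k+1 i)))
  where
  lag : ℕ → ℕ
  lag i = n ℕ.+ (k ℕ.∸ i)
  lag<n+k+1 : ∀ i → lag i < n ℕ.+ suc k
  lag<n+k+1 i = ℕ.+-monoʳ-< n (s≤s (ℕ.m∸n≤m k i))

∣s∣≤^ : ∀ k α s c .{{_ : NonZero c}} → satisfiesRec k α s → sum (map ∣_∣ α) ≤ c →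
  (∀ i → i ≤ k → ∣ s i ∣ ≤ c ℕ.^ suc i) → ∀ n → ∣ s n ∣ ≤ c ℕ.^ suc n
∣s∣≤^ k α s c rec ∑∣α∣≤c initial = <-rec P step
  where
  P : ℕ → Set
  P n = ∣ s n ∣ ≤ c ℕ.^ suc n
  beyond : ∀ m {n} → m ℕ.+ suc k ≡ n → (∀ {i} → i < n → P i) → P n
  beyond m refl ih = ℕ.≤-trans
    (∣s[n+k+1]∣≤ k α s rec m (λ i i<n → ℕ.≤-trans (ih i<n) (ℕ.^-monoʳ-≤ c i<n)))
    (ℕ.*-monoˡ-≤ _ ∑∣α∣≤c)
  step : ∀ n → (∀ {i} → i < n → P i) → P n
  step n ih with n ℕ.≤? k
  ... | yes n≤k = initial n n≤k
  ... | no  n≰k = beyond (n ℕ.∸ suc k) (ℕ.m∸n+n≡m (ℕ.≰⇒> n≰k)) ih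

growthBase : ∀ {k} → Vec ℤ (suc k) → (ℕ → ℤ) → ℕ
growthBase {k} α s = suc (sum (map ∣_∣ α) ℕ.+ maxAbs s k)

∣s∣≤growthBase^ : ∀ k α s → satisfiesRec k α s → ∀ n → ∣ s n ∣ ≤ growthBase α s ℕ.^ suc n
∣s∣≤growthBase^ k α s rec = ∣s∣≤^ k α s c rec (ℕ.m≤n⇒m≤1+n (ℕ.m≤m+n A B)) initial
  where
  A = sum (map ∣_∣ α)
  B = maxAbs s k
  c = growthBase α s
  initial : ∀ i → i ≤ k → ∣ s i ∣ ≤ c ℕ.^ suc i
  initial i i≤k = ℕ.≤-trans (∣s∣≤maxAbs s i≤k)
    (ℕ.≤-trans (ℕ.m≤n⇒m≤1+n (ℕ.m≤n+m B A)) (ℕ.m≤m*n c (c ℕ.^ i) {{ℕ.m^n≢0 c i}}))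

pos-^ : ∀ m n → (+ m) ^ n ≡ + (m ℕ.^ n)
pos-^ m zero    = refl
pos-^ m (suc n) = trans (cong (_*_ (+ m)) (pos-^ m n)) (sym (ℤ.pos-* m (m ℕ.^ n)))

∣i∣≤n⇒i+n≥0 : ∀ i {n} → ∣ i ∣ ≤ n → i + + n ≥ 0ℤ
∣i∣≤n⇒i+n≥0 (+ _)    _     = +≤+ z≤n
∣i∣≤n⇒i+n≥0 -[1+ _ ] ∣i∣≤n rewrite ℤ.⊖-≥ ∣i∣≤n = +≤+ z≤n

theorem4 : (s : ℕ → ℤ) → CRecursive s →
    Σ ℕ λ c → CRecursive (λ n → s n + (+ c) ^ suc n)
      × (∀ n → s n + (+ c) ^ suc n ≥ + 0)
theorem4 s s-rec@(k , α , _ , rec) =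
  c , CRecursive-+-geometric s (+ c) (λ ()) s-rec , nonneg
  where
  c = growthBase α s
  nonneg : ∀ n → s n + (+ c) ^ suc n ≥ + 0
  nonneg n rewrite pos-^ c (suc n) = ∣i∣≤n⇒i+n≥0 (s n) (∣s∣≤growthBase^ k α s rec n)
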